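{- Let $k \geq 4$ be a fixed integer. There is a constant $a_k$ depending only on $k$ such that for every finite projective plane $\Pi$ of order $n$ with $n \geq k$, the Levi graph $\Gamma_{\Pi}$ satisfies $$c_{2k}(\Gamma_{\Pi}) > \frac{1}{2k}N_{(k)} - \frac{1}{2}(n-1)N_{(k-1)} - \frac{(k-1)(k-2)}{2k}N_{(k-1)} - a_k n^{2k-2}.$$
   Context: $N = n^2+n+1$; for a positive integer $x$, $x_{(m)} = x(x-1)\cdots(x-m+1)$. The Levi graph $\Gamma_{\Pi}$ is the bipartite graph whose vertex classes are the points and the lines of $\Pi$, a point adjacent to a line iff it lies on it. $c_{2k}(\Gamma_{\Pi})$ is the number of cycles of length $2k$ in $\Gamma_{\Pi}$. -}

module Defs where

open import Data.Nat using (ℕ; zero; suc; _*_; _+_; _∸_; _/_)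
open import Data.Bool using (Bool; true; false; T; not; _∧_)
open import Data.Fin using (Fin; _≟_)
open import Data.List using (List; []; _∷_; [_]; _++_; map; concatMap; filterᵇ; length; allFin; zipWith)
open import Data.Bool.ListAction using (and; any)
open import Data.Product using (Σ; ∃; _×_; _,_)
import Data.Product
open import Relation.Binary.PropositionalEquality using (_≡_; _≢_)
open import Relation.Nullary.Decidable using (⌊_⌋)
open import Data.Integer using (+_)
open import Data.Rational using (ℚ; 0ℚ) renaming (_/_ to _/ℚ_)

¬3 : Bool → Bool → Bool → Set
¬3 x y z = T (not (x ∧ y ∧ z))

record ProjectivePlane (n : ℕ) : Set where
  field
    numPoints : ℕ
    numLines  : ℕ
    inc       : Fin numPoints → Fin numLines → Bool
    joinExists : ∀ p q → p ≢ q → ∃ λ l → T (inc p l) × T (inc q l)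
    joinUnique : ∀ p q → p ≢ q → ∀ l l' →
                 T (inc p l) → T (inc q l) → T (inc p l') → T (inc q l') → l ≡ l'
    meetExists : ∀ l m → l ≢ m → ∃ λ p → T (inc p l) × T (inc p m)
    meetUnique : ∀ l m → l ≢ m → ∀ p p' →
                 T (inc p l) → T (inc p m) → T (inc p' l) → T (inc p' m) → p ≡ p'
    nondegenerate : Σ (Fin numPoints) λ a → Σ (Fin numPoints) λ b →
                    Σ (Fin numPoints) λ c → Σ (Fin numPoints) λ d →
                    a ≢ b × a ≢ c × a ≢ d × b ≢ c × b ≢ d × c ≢ d ×
                    (∀ l → ¬3 (inc a l) (inc b l) (inc c l)) ×
                    (∀ l → ¬3 (inc a l) (inc b l) (inc d l)) ×
                    (∀ l → ¬3 (inc a l) (inc c l) (inc d l)) ×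
                    (∀ l → ¬3 (inc b l) (inc c l) (inc d l))
    order : ∀ l → length (filterᵇ (λ p → inc p l) (allFin numPoints)) ≡ suc n

ff : ℕ → ℕ → ℕ
ff x zero    = 1
ff x (suc m) = ff x m * (x ∸ m)

Nn : ℕ → ℕ
Nn n = n * n + n + 1

tuples : {A : Set} → ℕ → List A → List (List A)
tuples zero    xs = [ [] ]
tuples (suc m) xs = concatMap (λ x → map (x ∷_) (tuples m xs)) xs

distinct : {m : ℕ} → List (Fin m) → Bool
distinct []       = true
distinct (x ∷ xs) = not (any (λ y → ⌊ x ≟ y ⌋) xs) ∧ distinct xs

rotate : {A : Set} → List A → List A
rotate []       = []
rotate (x ∷ xs) = xs ++ [ x ]

module _ {n : ℕ} (Π : ProjectivePlane n) where
  open ProjectivePlane Π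

  -- (p1,...,pk),(l1,...,lk) describes the closed path
  -- p1 - l1 - p2 - l2 - ... - pk - lk - p1 in the Levi graph with all
  -- vertices distinct, i.e. p_i and p_{i+1} (indices mod k) lie on l_i.
  isCycleSeq : List (Fin numPoints) → List (Fin numLines) → Bool
  isCycleSeq ps ls =
    distinct ps ∧ distinct ls ∧
    and (zipWith inc ps ls) ∧ and (zipWith inc (rotate ps) ls)

  -- number of such sequences of length k (each 2k-cycle of the Levi graph
  -- with k ≥ 2 is described by exactly 2k of them: k choices of the
  -- starting point times 2 directions)
  cycleSeqCount : ℕ → ℕ
  cycleSeqCount k =
    length (filterᵇ (λ pl → isCycleSeq (Data.Product.proj₁ pl) (Data.Product.proj₂ pl))
      (concatMap (λ ps → map (ps ,_) (tuples k (allFin numLines)))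
                 (tuples k (allFin numPoints))))

  -- c_{2k}(Γ_Π): number of cycles of length 2k in the Levi graph
  levi-c : ℕ → ℕ
  levi-c zero    = 0
  levi-c (suc j) = cycleSeqCount (suc j) / (2 * suc j)

-- rational m / d (for d > 0; d = 0 never used)

frac : ℕ → ℕ → ℚ
frac m zero    = 0ℚ
frac m (suc d) = (+ m) /ℚ (suc d)

ℕ→ℚ : ℕ → ℚ
ℕ→ℚ m = frac m 1

-- Count point sequences instead of cycles.  A sequence of k distinct points
-- p₁ … p_k whose joining lines p₁p₂, …, p_kp₁ are pairwise distinct traces a
-- 2k-cycle of the Levi graph, and every 2k-cycle is traced by exactly 2k such
-- sequences.  There are N_(k) sequences of distinct points.  If the joining
-- lines of one of them are not distinct, then after a cyclic rotation the line
-- p₁p₂ also contains p₃ or two consecutive later points; since a line has n + 1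
-- points, at most N²((n+1)N^(k-3) + (k-3)(n+1)²N^(k-4)) sequences do so, and
-- each bad sequence is caught by one of its k rotations.  Hence
-- 2k c_{2k} > N_(k) - k(n+1)N^(k-1) - O(n^(2k-2)), and N^(k-1) ≤ N_(k-1) +
-- (k-1)²N^(k-2) turns this into the stated bound (without even needing its
-- (k-1)(k-2)/(2k) N_(k-1) term).

module Submission where

open import Defs

module Combinatorics where

  open import Data.Bool using (Bool; true; false; T; not; _∧_; _∨_; if_then_else_)
  open import Data.Bool.ListAction using (any; and)
  open import Data.Bool.Properties using (T-∧; T-∨; T-not-≡; ∧-comm)
  open import Data.Empty using (⊥; ⊥-elim)
  open import Data.Fin using (Fin; _≟_)
  open import Data.List
    using (List; []; _∷_; [_]; _++_; _∷ʳ_; map; concatMap; filterᵇ; length; drop; take; initLast; _∷ʳ′_;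
           zipWith; allFin; upTo)
  open import Data.List.Membership.Propositional using (_∈_; lose)
  open import Data.List.Membership.Propositional.Properties
    using (∈-filter⁺; ∈-filter⁻; ∈-map⁺; ∈-map⁻; ∈-concatMap⁺; ∈-concatMap⁻; ∈-++⁺ˡ; ∈-++⁺ʳ; ∈-++⁻;
           ∈-allFin; ∈-upTo⁺)
  open import Data.List.Properties
    using (++-assoc; ++-identityʳ; length-++; length-drop; drop-all; take-all; ∷ʳ-injective; ∷ʳ-injectiveˡ;
           ∷-injective; length-zipWith; length-upTo; length-tabulate)
  open import Data.List.Relation.Binary.Pointwise using (Pointwise; []; _∷_)
  open import Data.List.Relation.Unary.All using (All; []; _∷_)
  import Data.List.Relation.Unary.All as All
  open import Data.List.Relation.Unary.Any using (here; there)
  import Data.List.Relation.Unary.Any as Any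
  open import Data.List.Relation.Unary.Any.Properties using (any⁺)
  open import Data.List.Relation.Unary.Unique.Propositional using (Unique; []; _∷_)
  import Data.List.Relation.Unary.Unique.Propositional.Properties as Unique
  open import Data.Nat using (ℕ; zero; suc; _+_; _*_; _∸_; _≤_; _<_; _^_; _⊓_; _/_; NonZero; z≤n; s≤s)
  open import Data.Nat.DivMod using (m≡m%n+[m/n]*n; m%n<n)
  open import Data.Nat.Properties hiding (_≟_)
  open import Data.Nat.Tactic.RingSolver using (solve-∀)
  open import Data.Product using (_,_; _×_; ∃-syntax; proj₁; proj₂)
  open import Data.Sum using (inj₁; inj₂)
  open import Data.Unit using (tt)
  open import Function using (_∘_)
  open import Function.Bundles using (module Equivalence)
  open import Relation.Binary.PropositionalEquality hiding ([_])
  open import Relation.Nullary using (¬_; yes; no)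
  open import Relation.Nullary.Decidable using (⌊_⌋; toWitness; fromWitness; T?)

  open Equivalence using (to; from)

  variable
    A B C : Set

  count : (A → Bool) → List A → ℕ
  count p []       = 0
  count p (x ∷ xs) = if p x then suc (count p xs) else count p xs

  ∑ : (A → ℕ) → List A → ℕ
  ∑ f []       = 0
  ∑ f (x ∷ xs) = f x + ∑ f xs

  infix 5 ∑
  syntax ∑ (λ x → e) xs = ∑[ x ∈ xs ] e

  length-filterᵇ : (p : A → Bool) (xs : List A) → length (filterᵇ p xs) ≡ count p xs
  length-filterᵇ p [] = refl
  length-filterᵇ p (x ∷ xs) with p x
  ... | true  = cong suc (length-filterᵇ p xs)
  ... | false = length-filterᵇ p xs

  count-++ : (p : A → Bool) (xs ys : List A) → count p (xs ++ ys) ≡ count p xs + count p ys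
  count-++ p [] ys = refl
  count-++ p (x ∷ xs) ys with p x
  ... | true  = cong suc (count-++ p xs ys)
  ... | false = count-++ p xs ys

  count-false : (xs : List A) → count (λ _ → false) xs ≡ 0
  count-false []       = refl
  count-false (x ∷ xs) = count-false xs

  count-true : (xs : List A) → count (λ _ → true) xs ≡ length xs
  count-true []       = refl
  count-true (x ∷ xs) = cong suc (count-true xs)

  count-cong : (p q : A → Bool) (xs : List A) → (∀ x → p x ≡ q x) → count p xs ≡ count q xs
  count-cong p q [] p≡q = refl
  count-cong p q (x ∷ xs) p≡q rewrite p≡q x = cong (λ c → if q x then suc c else c) (count-cong p q xs p≡q)

  count-split : (p q : A → Bool) (xs : List A) →
    count p xs ≡ count (λ x → p x ∧ q x) xs + count (λ x → p x ∧ not (q x)) xs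
  count-split p q [] = refl
  count-split p q (x ∷ xs) with p x | q x
  ... | true  | true  = cong suc (count-split p q xs)
  ... | true  | false = trans (cong suc (count-split p q xs)) (sym (+-suc _ _))
  ... | false | _     = count-split p q xs

  count-∨ : (p q : A → Bool) (xs : List A) → count (λ x → p x ∨ q x) xs ≤ count p xs + count q xs
  count-∨ p q [] = z≤n
  count-∨ p q (x ∷ xs) with p x | q x
  ... | true  | true  = s≤s (≤-trans (count-∨ p q xs) (+-monoʳ-≤ (count p xs) (n≤1+n _)))
  ... | true  | false = s≤s (count-∨ p q xs)
  ... | false | true  = ≤-trans (s≤s (count-∨ p q xs)) (≤-reflexive (sym (+-suc _ _)))
  ... | false | false = count-∨ p q xs

  count-map : (p : B → Bool) (f : A → B) (xs : List A) → count p (map f xs) ≡ count (p ∘ f) xs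
  count-map p f [] = refl
  count-map p f (x ∷ xs) with p (f x)
  ... | true  = cong suc (count-map p f xs)
  ... | false = count-map p f xs

  count≡0 : (p : A → Bool) (xs : List A) → (∀ x → x ∈ xs → T (p x) → ⊥) → count p xs ≡ 0
  count≡0 p [] none = refl
  count≡0 p (x ∷ xs) none with p x in px
  ... | true  = ⊥-elim (none x (here refl) (subst T (sym px) tt))
  ... | false = count≡0 p xs (λ y y∈ → none y (there y∈))

  count≡1 : (p : A → Bool) {xs : List A} → Unique xs → {y : A} → y ∈ xs → T (p y) →
            (∀ x x′ → x ∈ xs → x′ ∈ xs → T (p x) → T (p x′) → x ≡ x′) → count p xs ≡ 1
  count≡1 p {x ∷ xs} (x∉xs ∷ uniq) y∈ py unique with p x in px
  ... | true  = cong suc (count≡0 p xs λ x′ x′∈ px′ →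
                  All.lookup x∉xs x′∈ (unique x x′ (here refl) (there x′∈) (subst T (sym px) tt) px′))
  ... | false with y∈
  ...   | here refl  = ⊥-elim (subst T px py)
  ...   | there y∈xs = count≡1 p uniq y∈xs py (λ x x′ x∈ x′∈ → unique x x′ (there x∈) (there x′∈))

  ∑-cong : (f g : A → ℕ) (xs : List A) → (∀ x → f x ≡ g x) → ∑ f xs ≡ ∑ g xs
  ∑-cong f g [] f≡g = refl
  ∑-cong f g (x ∷ xs) f≡g = cong₂ _+_ (f≡g x) (∑-cong f g xs f≡g)

  ∑-cong-∈ : (f g : A → ℕ) (xs : List A) → (∀ x → x ∈ xs → f x ≡ g x) → ∑ f xs ≡ ∑ g xs
  ∑-cong-∈ f g [] f≡g = refl
  ∑-cong-∈ f g (x ∷ xs) f≡g = cong₂ _+_ (f≡g x (here refl)) (∑-cong-∈ f g xs (λ y y∈ → f≡g y (there y∈)))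

  ∑-mono-≤ : (f g : A → ℕ) (xs : List A) → (∀ x → x ∈ xs → f x ≤ g x) → ∑ f xs ≤ ∑ g xs
  ∑-mono-≤ f g [] f≤g = z≤n
  ∑-mono-≤ f g (x ∷ xs) f≤g = +-mono-≤ (f≤g x (here refl)) (∑-mono-≤ f g xs (λ y y∈ → f≤g y (there y∈)))

  ∑-const : (c : ℕ) (xs : List A) → ∑[ _ ∈ xs ] c ≡ length xs * c
  ∑-const c [] = refl
  ∑-const c (x ∷ xs) = cong (c +_) (∑-const c xs)

  ∑-zero : (xs : List A) → ∑[ _ ∈ xs ] 0 ≡ 0
  ∑-zero xs = trans (∑-const 0 xs) (*-zeroʳ (length xs))

  ∑-≤-const : (f : A → ℕ) (c : ℕ) (xs : List A) → (∀ x → f x ≤ c) → ∑ f xs ≤ length xs * c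
  ∑-≤-const f c xs f≤c = ≤-trans (∑-mono-≤ f (λ _ → c) xs (λ x _ → f≤c x)) (≤-reflexive (∑-const c xs))

  ∑-+ : (f g : A → ℕ) (xs : List A) → ∑[ x ∈ xs ] (f x + g x) ≡ ∑ f xs + ∑ g xs
  ∑-+ f g [] = refl
  ∑-+ f g (x ∷ xs) rewrite ∑-+ f g xs = interchange (f x) (g x) (∑ f xs) (∑ g xs)
    where
    interchange : ∀ a b c d → a + b + (c + d) ≡ a + c + (b + d)
    interchange = solve-∀

  ∑-indicator : (p : A → Bool) (c : ℕ) (xs : List A) → ∑[ x ∈ xs ] (if p x then c else 0) ≡ count p xs * c
  ∑-indicator p c [] = refl
  ∑-indicator p c (x ∷ xs) with p x
  ... | true  = cong (c +_) (∑-indicator p c xs)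
  ... | false = ∑-indicator p c xs

  count-as-∑ : (p : A → Bool) (xs : List A) → count p xs ≡ ∑[ x ∈ xs ] (if p x then 1 else 0)
  count-as-∑ p xs = sym (trans (∑-indicator p 1 xs) (*-identityʳ _))

  ∑-filterᵇ : (p : A → Bool) (f : A → ℕ) (xs : List A) → ∑[ x ∈ xs ] (if p x then f x else 0) ≡ ∑ f (filterᵇ p xs)
  ∑-filterᵇ p f [] = refl
  ∑-filterᵇ p f (x ∷ xs) with p x
  ... | true  = cong (f x +_) (∑-filterᵇ p f xs)
  ... | false = ∑-filterᵇ p f xs

  ∑-swap : (f : A → B → ℕ) (xs : List A) (ys : List B) →
           ∑[ x ∈ xs ] ∑[ y ∈ ys ] f x y ≡ ∑[ y ∈ ys ] ∑[ x ∈ xs ] f x y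
  ∑-swap f [] ys = sym (∑-zero ys)
  ∑-swap f (x ∷ xs) ys = trans (cong (∑ (f x) ys +_) (∑-swap f xs ys)) (sym (∑-+ (f x) _ ys))

  count-concatMap : (p : C → Bool) (g : A → B → C) (ys : List B) (xs : List A) →
                    count p (concatMap (λ x → map (g x) ys) xs) ≡ ∑[ x ∈ xs ] count (λ y → p (g x y)) ys
  count-concatMap p g ys [] = refl
  count-concatMap p g ys (x ∷ xs) =
    trans (count-++ p (map (g x) ys) _) (cong₂ _+_ (count-map p (g x) ys) (count-concatMap p g ys xs))

  count-mono : (p q : A → Bool) (xs : List A) → (∀ x → x ∈ xs → T (p x) → T (q x)) →
    count p xs ≤ count q xs
  count-mono p q [] p⇒q = z≤n
  count-mono p q (x ∷ xs) p⇒q with p x | q x | p⇒q x (here refl)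
  ... | true  | true  | _  = s≤s (count-mono p q xs (λ y y∈ → p⇒q y (there y∈)))
  ... | true  | false | pq = ⊥-elim (pq tt)
  ... | false | true  | _  = m≤n⇒m≤1+n (count-mono p q xs (λ y y∈ → p⇒q y (there y∈)))
  ... | false | false | _  = count-mono p q xs (λ y y∈ → p⇒q y (there y∈))

  count-any : (p : B → A → Bool) (rs : List B) (xs : List A) →
    count (λ x → any (λ r → p r x) rs) xs ≤ ∑[ r ∈ rs ] count (p r) xs
  count-any p [] xs = ≤-reflexive (count-false xs)
  count-any p (r ∷ rs) xs =
    ≤-trans (count-∨ (p r) (λ x → any (λ r → p r x) rs) xs) (+-monoʳ-≤ (count (p r) xs) (count-any p rs xs))

  ∈⇒1≤count : (p : A → Bool) {x : A} {xs : List A} → x ∈ xs → T (p x) → 1 ≤ count p xs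
  ∈⇒1≤count p {xs = y ∷ xs} x∈ px with p y in py
  ... | true = s≤s z≤n
  ... | false with x∈
  ...   | here refl  = ⊥-elim (subst T py px)
  ...   | there x∈xs = ∈⇒1≤count p x∈xs px

  count-≤-∑ : (p : A → Bool) (f : A → ℕ) (xs : List A) →
    (∀ x → x ∈ xs → T (p x) → 1 ≤ f x) → count p xs ≤ ∑ f xs
  count-≤-∑ p f [] _ = z≤n
  count-≤-∑ p f (x ∷ xs) p⇒1≤f with p x | p⇒1≤f x (here refl)
  ... | true  | 1≤fx = +-mono-≤ (1≤fx tt) (count-≤-∑ p f xs (λ y y∈ → p⇒1≤f y (there y∈)))
  ... | false | _    = ≤-trans (count-≤-∑ p f xs (λ y y∈ → p⇒1≤f y (there y∈))) (m≤n+m _ (f x))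

  count-tuples-suc : (p : List A → Bool) (m : ℕ) (xs : List A) →
    count p (tuples (suc m) xs) ≡ ∑[ x ∈ xs ] count (λ ys → p (x ∷ ys)) (tuples m xs)
  count-tuples-suc p m xs = count-concatMap p _∷_ (tuples m xs) xs

  count-true-tuples : (m : ℕ) (xs : List A) → count (λ _ → true) (tuples m xs) ≡ length xs ^ m
  count-true-tuples zero xs = refl
  count-true-tuples (suc m) xs = begin
    count (λ _ → true) (tuples (suc m) xs)      ≡⟨ count-tuples-suc (λ _ → true) m xs ⟩
    ∑[ x ∈ xs ] count (λ _ → true) (tuples m xs) ≡⟨ ∑-cong _ _ xs (λ _ → count-true-tuples m xs) ⟩
    ∑[ x ∈ xs ] length xs ^ m                    ≡⟨ ∑-const _ xs ⟩
    length xs ^ suc m                            ∎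
    where open ≡-Reasoning

  ∈-tuples⁻ : {m : ℕ} {xs ys : List A} → ys ∈ tuples m xs → length ys ≡ m
  ∈-tuples⁻ {m = zero} (here refl) = refl
  ∈-tuples⁻ {m = suc m} {xs = xs} ys∈ with Any.satisfied (∈-concatMap⁻ (λ x → map (x ∷_) (tuples m xs)) {xs = xs} ys∈)
  ... | x , ys∈x∷ with ∈-map⁻ (x ∷_) ys∈x∷
  ... | zs , zs∈ , refl = cong suc (∈-tuples⁻ zs∈)

  ∈-tuples⁺ : {xs ys : List A} → All (_∈ xs) ys → ys ∈ tuples (length ys) xs
  ∈-tuples⁺ [] = here refl
  ∈-tuples⁺ {xs = xs} {ys = y ∷ ys} (y∈ ∷ ys∈) =
    ∈-concatMap⁺ (λ x → map (x ∷_) (tuples (length ys) xs))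
      (Any.map (λ { refl → ∈-map⁺ (y ∷_) (∈-tuples⁺ ys∈) }) y∈)

  count-tuples-snoc : (p : List A → Bool) (m : ℕ) (xs : List A) →
    count p (tuples (suc m) xs) ≡ ∑[ x ∈ xs ] count (λ ys → p (ys ++ [ x ])) (tuples m xs)
  count-tuples-snoc p zero xs = count-tuples-suc p zero xs
  count-tuples-snoc p (suc m) xs = begin
    count p (tuples (suc (suc m)) xs)
      ≡⟨ count-tuples-suc p (suc m) xs ⟩
    ∑[ y ∈ xs ] count (λ ys → p (y ∷ ys)) (tuples (suc m) xs)
      ≡⟨ ∑-cong _ _ xs (λ y → count-tuples-snoc (λ ys → p (y ∷ ys)) m xs) ⟩
    ∑[ y ∈ xs ] ∑[ x ∈ xs ] count (λ ws → p (y ∷ ws ++ [ x ])) (tuples m xs)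
      ≡⟨ ∑-swap (λ y x → count (λ ws → p (y ∷ ws ++ [ x ])) (tuples m xs)) xs xs ⟩
    ∑[ x ∈ xs ] ∑[ y ∈ xs ] count (λ ws → p (y ∷ ws ++ [ x ])) (tuples m xs)
      ≡⟨ ∑-cong _ _ xs (λ x → sym (count-tuples-suc (λ ys → p (ys ++ [ x ])) m xs)) ⟩
    ∑[ x ∈ xs ] count (λ ys → p (ys ++ [ x ])) (tuples (suc m) xs)
      ∎
    where open ≡-Reasoning

  count-tuples-rotate : (p : List A → Bool) (m : ℕ) (xs : List A) →
    count (p ∘ rotate) (tuples m xs) ≡ count p (tuples m xs)
  count-tuples-rotate p zero xs = refl
  count-tuples-rotate p (suc m) xs =
    trans (count-tuples-suc (p ∘ rotate) m xs) (sym (count-tuples-snoc p m xs))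

  rotate^ : ℕ → List A → List A
  rotate^ zero    xs = xs
  rotate^ (suc r) xs = rotate^ r (rotate xs)

  count-tuples-rotate^ : (p : List A → Bool) (r m : ℕ) (xs : List A) →
    count (p ∘ rotate^ r) (tuples m xs) ≡ count p (tuples m xs)
  count-tuples-rotate^ p zero m xs = refl
  count-tuples-rotate^ p (suc r) m xs =
    trans (count-tuples-rotate (p ∘ rotate^ r) m xs) (count-tuples-rotate^ p r m xs)

  module _ (S : A → Bool) where

    startsIn : List A → Bool
    startsIn []      = false
    startsIn (x ∷ _) = S x

    adjacentIn : List A → Bool
    adjacentIn (x ∷ y ∷ ys) = (S x ∧ S y) ∨ adjacentIn (y ∷ ys)
    adjacentIn _            = false

    count-const-tuples : (b : Bool) (m : ℕ) (xs : List A) →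
      count (λ _ → b) (tuples m xs) ≡ (if b then length xs ^ m else 0)
    count-const-tuples true  m xs = count-true-tuples m xs
    count-const-tuples false m xs = count-false (tuples m xs)

    count-startsIn : (m : ℕ) (xs : List A) → count startsIn (tuples (suc m) xs) ≡ count S xs * length xs ^ m
    count-startsIn m xs = begin
      count startsIn (tuples (suc m) xs)                   ≡⟨ count-tuples-suc startsIn m xs ⟩
      ∑[ x ∈ xs ] count (λ _ → S x) (tuples m xs)          ≡⟨ ∑-cong _ _ xs (λ x → count-const-tuples (S x) m xs) ⟩
      ∑[ x ∈ xs ] (if S x then length xs ^ m else 0)       ≡⟨ ∑-indicator S (length xs ^ m) xs ⟩
      count S xs * length xs ^ m                           ∎
      where open ≡-Reasoning

    adjacentIn-∷ : (x : A) (xs : List A) → T (adjacentIn (x ∷ xs)) → T (startsIn xs ∨ adjacentIn xs)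
    adjacentIn-∷ x (y ∷ ys) adj with to (T-∨ {S x ∧ S y}) adj
    ... | inj₁ Sx∧Sy = from (T-∨ {S y}) (inj₁ (proj₂ (to (T-∧ {S x}) Sx∧Sy)))
    ... | inj₂ adj′  = from (T-∨ {S y}) (inj₂ adj′)

    ∑∑-indicator-∧ : (c : ℕ) (xs : List A) →
      ∑[ x ∈ xs ] ∑[ y ∈ xs ] (if S x ∧ S y then c else 0) ≡ count S xs * (count S xs * c)
    ∑∑-indicator-∧ c xs = trans (∑-cong _ _ xs inner) (∑-indicator S (count S xs * c) xs)
      where
      inner : ∀ x → ∑[ y ∈ xs ] (if S x ∧ S y then c else 0) ≡ (if S x then count S xs * c else 0)
      inner x with S x
      ... | true  = ∑-indicator S c xs
      ... | false = ∑-zero xs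

    count-adjacentIn-step : (m : ℕ) (xs : List A) →
      count adjacentIn (tuples (suc (suc m)) xs) ≤
      count S xs * (count S xs * length xs ^ m) + length xs * count adjacentIn (tuples (suc m) xs)
    count-adjacentIn-step m xs = begin
      count adjacentIn (tuples (suc (suc m)) xs)
        ≡⟨ count-tuples-suc adjacentIn (suc m) xs ⟩
      ∑[ x ∈ xs ] count (λ ys → adjacentIn (x ∷ ys)) (tuples (suc m) xs)
        ≡⟨ ∑-cong _ _ xs (λ x → count-tuples-suc _ m xs) ⟩
      ∑[ x ∈ xs ] ∑[ y ∈ xs ] count (λ zs → (S x ∧ S y) ∨ adjacentIn (y ∷ zs)) (tuples m xs)
        ≤⟨ ∑-mono-≤ _ _ xs (λ x _ → split x) ⟩
      ∑[ x ∈ xs ] ((∑[ y ∈ xs ] count (λ _ → S x ∧ S y) (tuples m xs)) + count adjacentIn (tuples (suc m) xs))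
        ≡⟨ ∑-+ _ _ xs ⟩
      (∑[ x ∈ xs ] ∑[ y ∈ xs ] count (λ _ → S x ∧ S y) (tuples m xs)) + (∑[ _ ∈ xs ] count adjacentIn (tuples (suc m) xs))
        ≡⟨ cong₂ _+_ pairs (∑-const _ xs) ⟩
      count S xs * (count S xs * length xs ^ m) + length xs * count adjacentIn (tuples (suc m) xs)
        ∎
      where
      open ≤-Reasoning
      split : ∀ x → ∑[ y ∈ xs ] count (λ zs → (S x ∧ S y) ∨ adjacentIn (y ∷ zs)) (tuples m xs)
                  ≤ (∑[ y ∈ xs ] count (λ _ → S x ∧ S y) (tuples m xs)) + count adjacentIn (tuples (suc m) xs)
      split x = begin
        ∑[ y ∈ xs ] count (λ zs → (S x ∧ S y) ∨ adjacentIn (y ∷ zs)) (tuples m xs)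
          ≤⟨ ∑-mono-≤ _ _ xs (λ y _ → count-∨ (λ _ → S x ∧ S y) (λ zs → adjacentIn (y ∷ zs)) (tuples m xs)) ⟩
        ∑[ y ∈ xs ] (count (λ _ → S x ∧ S y) (tuples m xs) + count (λ zs → adjacentIn (y ∷ zs)) (tuples m xs))
          ≡⟨ ∑-+ _ _ xs ⟩
        (∑[ y ∈ xs ] count (λ _ → S x ∧ S y) (tuples m xs)) + (∑[ y ∈ xs ] count (λ zs → adjacentIn (y ∷ zs)) (tuples m xs))
          ≡⟨ cong ((∑[ y ∈ xs ] count (λ _ → S x ∧ S y) (tuples m xs)) +_) (count-tuples-suc adjacentIn m xs) ⟨
        (∑[ y ∈ xs ] count (λ _ → S x ∧ S y) (tuples m xs)) + count adjacentIn (tuples (suc m) xs)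
          ∎
      pairs : ∑[ x ∈ xs ] ∑[ y ∈ xs ] count (λ _ → S x ∧ S y) (tuples m xs) ≡ count S xs * (count S xs * length xs ^ m)
      pairs = trans (∑-cong _ _ xs (λ x → ∑-cong _ _ xs (λ y → count-const-tuples (S x ∧ S y) m xs)))
                    (∑∑-indicator-∧ (length xs ^ m) xs)

    count-adjacentIn : (m : ℕ) (xs : List A) →
      count adjacentIn (tuples (suc (suc m)) xs) ≤ suc m * (count S xs * (count S xs * length xs ^ m))
    count-adjacentIn zero xs = ≤-trans (count-adjacentIn-step zero xs) (≤-reflexive (begin
      s * (s * 1) + length xs * count adjacentIn (tuples 1 xs) ≡⟨ cong (λ c → s * (s * 1) + length xs * c) none ⟩
      s * (s * 1) + length xs * 0                             ≡⟨ arith s (length xs) ⟩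
      1 * (s * (s * 1))                                       ∎))
      where
      open ≡-Reasoning
      s = count S xs
      none : count adjacentIn (tuples 1 xs) ≡ 0
      none = trans (count-tuples-suc adjacentIn 0 xs) (∑-zero xs)
      arith : ∀ s l → s * (s * 1) + l * 0 ≡ 1 * (s * (s * 1))
      arith = solve-∀
    count-adjacentIn (suc m) xs = begin
      count adjacentIn (tuples (suc (suc (suc m))) xs)
        ≤⟨ count-adjacentIn-step (suc m) xs ⟩
      s * (s * (l * l ^ m)) + l * count adjacentIn (tuples (suc (suc m)) xs)
        ≤⟨ +-monoʳ-≤ (s * (s * (l * l ^ m))) (*-monoʳ-≤ l (count-adjacentIn m xs)) ⟩
      s * (s * (l * l ^ m)) + l * (suc m * (s * (s * l ^ m)))
        ≡⟨ arith s l (l ^ m) m ⟩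
      suc (suc m) * (s * (s * (l * l ^ m)))
        ∎
      where
      open ≤-Reasoning
      s = count S xs
      l = length xs
      arith : ∀ s l p m → s * (s * (l * p)) + l * (suc m * (s * (s * p))) ≡ suc (suc m) * (s * (s * (l * p)))
      arith = solve-∀

  ff-suc : ∀ x m → ff x (suc m) ≡ x * ff (x ∸ 1) m
  ff-suc x zero = trans (*-identityˡ (x ∸ 0)) (sym (*-identityʳ x))
  ff-suc x (suc m) = begin
    ff x (suc m) * (x ∸ suc m)          ≡⟨ cong₂ _*_ (ff-suc x m) (sym (∸-+-assoc x 1 m)) ⟩
    x * ff (x ∸ 1) m * (x ∸ 1 ∸ m)      ≡⟨ *-assoc x _ _ ⟩
    x * (ff (x ∸ 1) m * (x ∸ 1 ∸ m))    ∎
    where open ≡-Reasoning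

  count-tuples-avoiding : (f : A → Bool) (p : List A → Bool) (m : ℕ) (xs : List A) →
    count (λ ys → not (any f ys) ∧ p ys) (tuples m xs) ≡ count p (tuples m (filterᵇ (not ∘ f) xs))
  count-tuples-avoiding f p zero xs = refl
  count-tuples-avoiding f p (suc m) xs = begin
    count (λ ys → not (any f ys) ∧ p ys) (tuples (suc m) xs)
      ≡⟨ count-tuples-suc _ m xs ⟩
    ∑[ x ∈ xs ] count (λ ys → not (f x ∨ any f ys) ∧ p (x ∷ ys)) (tuples m xs)
      ≡⟨ ∑-cong _ _ xs avoid-head ⟩
    ∑[ x ∈ xs ] (if not (f x) then count (λ ys → p (x ∷ ys)) (tuples m xs′) else 0)
      ≡⟨ ∑-filterᵇ (not ∘ f) _ xs ⟩
    ∑[ x ∈ xs′ ] count (λ ys → p (x ∷ ys)) (tuples m xs′)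
      ≡⟨ count-tuples-suc p m xs′ ⟨
    count p (tuples (suc m) xs′)
      ∎
    where
    open ≡-Reasoning
    xs′ = filterᵇ (not ∘ f) xs
    avoid-head : ∀ x → count (λ ys → not (f x ∨ any f ys) ∧ p (x ∷ ys)) (tuples m xs)
                     ≡ (if not (f x) then count (λ ys → p (x ∷ ys)) (tuples m xs′) else 0)
    avoid-head x with f x
    ... | true  = count-false (tuples m xs)
    ... | false = count-tuples-avoiding f (λ ys → p (x ∷ ys)) m xs

  count-≢ : {N : ℕ} {xs : List (Fin N)} → Unique xs → {x : Fin N} → x ∈ xs →
            suc (count (λ y → not ⌊ x ≟ y ⌋) xs) ≡ length xs
  count-≢ {xs = xs} uniq {x} x∈ = begin
    suc (count (λ y → not ⌊ x ≟ y ⌋) xs)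
      ≡⟨ cong (_+ count (λ y → not ⌊ x ≟ y ⌋) xs) one ⟨
    count (λ y → ⌊ x ≟ y ⌋) xs + count (λ y → not ⌊ x ≟ y ⌋) xs
      ≡⟨ count-split (λ _ → true) (λ y → ⌊ x ≟ y ⌋) xs ⟨
    count (λ _ → true) xs
      ≡⟨ count-true xs ⟩
    length xs
      ∎
    where
    open ≡-Reasoning
    one : count (λ y → ⌊ x ≟ y ⌋) xs ≡ 1
    one = count≡1 _ uniq x∈ (fromWitness refl) (λ y y′ _ _ x≡y x≡y′ → trans (sym (toWitness x≡y)) (toWitness x≡y′))

  count-distinct-tuples : {N : ℕ} (m : ℕ) {xs : List (Fin N)} → Unique xs → count distinct (tuples m xs) ≡ ff (length xs) m
  count-distinct-tuples zero uniq = refl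
  count-distinct-tuples (suc m) {xs = xs} uniq = begin
    count distinct (tuples (suc m) xs)
      ≡⟨ count-tuples-suc distinct m xs ⟩
    ∑[ x ∈ xs ] count (λ ys → not (any (λ y → ⌊ x ≟ y ⌋) ys) ∧ distinct ys) (tuples m xs)
      ≡⟨ ∑-cong-∈ _ _ xs rest ⟩
    ∑[ _ ∈ xs ] ff (length xs ∸ 1) m
      ≡⟨ ∑-const _ xs ⟩
    length xs * ff (length xs ∸ 1) m
      ≡⟨ ff-suc (length xs) m ⟨
    ff (length xs) (suc m)
      ∎
    where
    open ≡-Reasoning
    rest : ∀ x → x ∈ xs →
      count (λ ys → not (any (λ y → ⌊ x ≟ y ⌋) ys) ∧ distinct ys) (tuples m xs) ≡ ff (length xs ∸ 1) m
    rest x x∈ = begin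
      count (λ ys → not (any (λ y → ⌊ x ≟ y ⌋) ys) ∧ distinct ys) (tuples m xs)
        ≡⟨ count-tuples-avoiding (λ y → ⌊ x ≟ y ⌋) distinct m xs ⟩
      count distinct (tuples m (filterᵇ (λ y → not ⌊ x ≟ y ⌋) xs))
        ≡⟨ count-distinct-tuples m (Unique.filter⁺ (T? ∘ (λ y → not ⌊ x ≟ y ⌋)) uniq) ⟩
      ff (length (filterᵇ (λ y → not ⌊ x ≟ y ⌋) xs)) m
        ≡⟨ cong (λ l → ff l m) (trans (length-filterᵇ _ xs) (cong (_∸ 1) (count-≢ uniq x∈))) ⟩
      ff (length xs ∸ 1) m
        ∎

  rotate^-++ : (r : ℕ) (xs ys : List A) → r ≤ length xs → rotate^ r (xs ++ ys) ≡ drop r xs ++ ys ++ take r xs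
  rotate^-++ zero xs ys _ = cong (xs ++_) (sym (++-identityʳ ys))
  rotate^-++ (suc r) (x ∷ xs) ys (s≤s r≤) = begin
    rotate^ r ((xs ++ ys) ++ [ x ])       ≡⟨ cong (rotate^ r) (++-assoc xs ys [ x ]) ⟩
    rotate^ r (xs ++ ys ++ [ x ])         ≡⟨ rotate^-++ r xs (ys ++ [ x ]) r≤ ⟩
    drop r xs ++ (ys ++ [ x ]) ++ take r xs ≡⟨ cong (drop r xs ++_) (++-assoc ys [ x ] (take r xs)) ⟩
    drop r xs ++ ys ++ x ∷ take r xs      ∎
    where open ≡-Reasoning

  rotate^-suc : (r : ℕ) (xs : List A) → rotate^ (suc r) xs ≡ rotate (rotate^ r xs)
  rotate^-suc zero    xs = refl
  rotate^-suc (suc r) xs = rotate^-suc r (rotate xs)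

  length-rotate : (xs : List A) → length (rotate xs) ≡ length xs
  length-rotate []       = refl
  length-rotate (x ∷ xs) = trans (length-++ xs) (+-comm (length xs) 1)

  length-rotate^ : (r : ℕ) (xs : List A) → length (rotate^ r xs) ≡ length xs
  length-rotate^ zero    xs = refl
  length-rotate^ (suc r) xs = trans (length-rotate^ r (rotate xs)) (length-rotate xs)

  HeadRecurs : List A → Set
  HeadRecurs xs = ∃[ h ] ∃[ t ] xs ≡ h ∷ t × h ∈ t

  HeadRecursBeforeLast : List A → Set
  HeadRecursBeforeLast xs = ∃[ h ] ∃[ t ] ∃[ z ] xs ≡ h ∷ t ++ [ z ] × h ∈ t

  ∈-any-≟ : {N : ℕ} {x : Fin N} (ys : List (Fin N)) → T (any (λ y → ⌊ x ≟ y ⌋) ys) → x ∈ ys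
  ∈-any-≟ {x = x} (y ∷ ys) t with x ≟ y
  ... | yes x≡y = here x≡y
  ... | no  _   = there (∈-any-≟ ys t)

  nonDistinct⇒headRecurs : {N : ℕ} (xs : List (Fin N)) → ¬ T (distinct xs) →
    ∃[ r ] r < length xs × HeadRecurs (rotate^ r xs)
  nonDistinct⇒headRecurs [] nd = ⊥-elim (nd tt)
  nonDistinct⇒headRecurs (x ∷ xs) nd with any (λ y → ⌊ x ≟ y ⌋) xs in x∈?
  ... | true  = 0 , s≤s z≤n , x , xs , refl , ∈-any-≟ xs (subst T (sym x∈?) tt)
  ... | false with nonDistinct⇒headRecurs xs nd
  ... | r , r< , h , t , xs↻ , h∈t with drop r xs in drop≡
  ... | [] = ⊥-elim (<⇒≱ r< (m∸n≡0⇒m≤n (trans (sym (length-drop r xs)) (cong length drop≡))))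
  ... | d ∷ ds = suc r , s≤s r< , d , ds ++ x ∷ take r xs , shifted , d∈
    where
    unshifted : h ∷ t ≡ d ∷ ds ++ take r xs
    unshifted = trans (sym xs↻) (trans (cong (rotate^ r) (sym (++-identityʳ xs)))
                  (trans (rotate^-++ r xs [] (<⇒≤ r<)) (cong (_++ take r xs) drop≡)))
    shifted : rotate^ r (xs ++ [ x ]) ≡ d ∷ ds ++ x ∷ take r xs
    shifted = trans (rotate^-++ r xs [ x ] (<⇒≤ r<)) (cong (_++ x ∷ take r xs) drop≡)
    d∈ : d ∈ ds ++ x ∷ take r xs
    d∈ with unshifted
    ... | refl with ∈-++⁻ ds h∈t
    ... | inj₁ h∈ds   = ∈-++⁺ˡ h∈ds
    ... | inj₂ h∈take = ∈-++⁺ʳ ds (there h∈take)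

  rotate-∷ʳ⁻ : (ws ys : List A) {y : A} → rotate ws ≡ ys ∷ʳ y → ws ≡ y ∷ ys
  rotate-∷ʳ⁻ [] []       ()
  rotate-∷ʳ⁻ [] (_ ∷ _)  ()
  rotate-∷ʳ⁻ (w ∷ ws) ys eq with ∷ʳ-injective ws ys eq
  ... | refl , refl = refl

  rotate-to-doubled-head : (xs : List A) {r : ℕ} {h : A} {t : List A} → r < length xs →
    rotate^ r xs ≡ h ∷ t ∷ʳ h → ∃[ r′ ] r′ < length xs × rotate^ r′ xs ≡ h ∷ h ∷ t
  rotate-to-doubled-head xs {zero} {h} {t} _ refl = suc (length t) , r′< , (begin
    rotate^ (length (h ∷ t)) ((h ∷ t) ++ [ h ])
      ≡⟨ rotate^-++ _ (h ∷ t) [ h ] ≤-refl ⟩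
    drop (length (h ∷ t)) (h ∷ t) ++ [ h ] ++ take (length (h ∷ t)) (h ∷ t)
      ≡⟨ cong₂ (λ d e → d ++ [ h ] ++ e) (drop-all _ (h ∷ t) ≤-refl) (take-all _ (h ∷ t) ≤-refl) ⟩
    h ∷ h ∷ t
      ∎)
    where
    open ≡-Reasoning
    r′< : suc (length t) < length (h ∷ t ∷ʳ h)
    r′< = s≤s (≤-reflexive (trans (+-comm 1 (length t)) (sym (length-++ t))))
  rotate-to-doubled-head xs {suc r} {h} {t} r< xs↻ =
    r , <-trans (n<1+n r) r< , rotate-∷ʳ⁻ (rotate^ r xs) (h ∷ t) (trans (sym (rotate^-suc r xs)) xs↻)

  -- If h recurs only as the last element, the two copies are cyclically adjacent; rotating them to
  -- the front puts the second copy before the last position as soon as the length is at least 3.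
  nonDistinct⇒headRecursBeforeLast : {N : ℕ} (xs : List (Fin N)) → 3 ≤ length xs → ¬ T (distinct xs) →
    ∃[ r ] r < length xs × HeadRecursBeforeLast (rotate^ r xs)
  nonDistinct⇒headRecursBeforeLast xs 3≤ nd with nonDistinct⇒headRecurs xs nd
  ... | r , r< , h , t , xs↻ , h∈t with initLast t
  ... | [] with h∈t
  ...   | ()
  nonDistinct⇒headRecursBeforeLast xs 3≤ nd | r , r< , h , t , xs↻ , h∈t | t′ ∷ʳ′ z with ∈-++⁻ t′ h∈t
  ... | inj₁ h∈t′ = r , r< , h , t′ , z , xs↻ , h∈t′
  ... | inj₂ (here refl) with rotate-to-doubled-head xs r< xs↻ | initLast t′
  ...   | r′ , r′< , xs↻′ | t″ ∷ʳ′ z′ = r′ , r′< , h , h ∷ t″ , z′ , xs↻′ , here refl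
  ...   | _ | [] = ⊥-elim (<⇒≱ 3≤ (≤-reflexive (trans (sym (length-rotate^ r xs)) (cong length xs↻))))

  zipWith-∷ʳ : (f : A → B → C) (xs : List A) (ys : List B) {x : A} {y : B} →
    length xs ≡ length ys → zipWith f (xs ∷ʳ x) (ys ∷ʳ y) ≡ zipWith f xs ys ∷ʳ f x y
  zipWith-∷ʳ f []       []       _  = refl
  zipWith-∷ʳ f (x ∷ xs) (y ∷ ys) eq = cong (f x y ∷_) (zipWith-∷ʳ f xs ys (suc-injective eq))

  zipWith-rotate : (f : A → B → C) (xs : List A) (ys : List B) →
    length xs ≡ length ys → zipWith f (rotate xs) (rotate ys) ≡ rotate (zipWith f xs ys)
  zipWith-rotate f []       []       _  = refl
  zipWith-rotate f (x ∷ xs) (y ∷ ys) eq = zipWith-∷ʳ f xs ys (suc-injective eq)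

  Unique-rotate : {xs : List A} → Unique xs → Unique (rotate xs)
  Unique-rotate [] = []
  Unique-rotate (x∉xs ∷ uniq) = Unique.++⁺ uniq ([] ∷ []) λ { (x∈xs , here refl) → All.lookup x∉xs x∈xs refl }

  Unique-rotate^ : (r : ℕ) {xs : List A} → Unique xs → Unique (rotate^ r xs)
  Unique-rotate^ zero    uniq = uniq
  Unique-rotate^ (suc r) uniq = Unique-rotate^ r (Unique-rotate uniq)

  ≢-successors : (y : A) (qs : List A) {x : A} → Unique (y ∷ qs) → All (x ≢_) (y ∷ qs) →
                 Pointwise _≢_ (y ∷ qs) (qs ∷ʳ x)
  ≢-successors y []       _              (x≢y ∷ []) = (λ y≡x → x≢y (sym y≡x)) ∷ []
  ≢-successors y (q ∷ qs) ((y≢q ∷ _) ∷ uniq) (_ ∷ x∉) = y≢q ∷ ≢-successors q qs uniq x∉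

  Unique⇒≢-rotate : {xs : List A} → Unique xs → 2 ≤ length xs → Pointwise _≢_ xs (rotate xs)
  Unique⇒≢-rotate {xs = x ∷ y ∷ qs} ((x≢y ∷ x∉) ∷ uniq) _ = x≢y ∷ ≢-successors y qs uniq (x≢y ∷ x∉)
  Unique⇒≢-rotate {xs = _ ∷ []} _ (s≤s ())

  distinct⇒Unique : {N : ℕ} (xs : List (Fin N)) → T (distinct xs) → Unique xs
  distinct⇒Unique [] _ = []
  distinct⇒Unique (x ∷ xs) dist with to T-∧ dist
  ... | x∉xs , dist-xs = x∉ xs x∉xs ∷ distinct⇒Unique xs dist-xs
    where
    x∉ : ∀ ys → T (not (any (λ y → ⌊ x ≟ y ⌋) ys)) → All (x ≢_) ys
    x∉ []       _ = []
    x∉ (y ∷ ys) t with x ≟ y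
    ... | no x≢y = x≢y ∷ x∉ ys t

  -- Projective planes

  recurrenceBound : (n N t : ℕ) → ℕ
  recurrenceBound n N t = N * (N * (suc n * N ^ suc t + suc t * (suc n * (suc n * N ^ t))))

  module _ {n : ℕ} (Π : ProjectivePlane n) where
    open ProjectivePlane Π

    points : List (Fin numPoints)
    points = allFin numPoints

    lines : List (Fin numLines)
    lines = allFin numLines

    lineWithPointOff : ∃[ l ] ∃[ q ] ¬ T (inc q l)
    lineWithPointOff with nondegenerate
    ... | a , b , c , _ , a≢b , _ , _ , _ , _ , _ , abc , _ with joinExists a b a≢b
    ... | l , al , bl = l , c , λ cl → subst T (to T-not-≡ (abc l)) (from T-∧ (al , from T-∧ (bl , cl)))

    -- join p p is an arbitrary line.
    join : Fin numPoints → Fin numPoints → Fin numLines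
    join p q with p ≟ q
    ... | yes _  = proj₁ lineWithPointOff
    ... | no p≢q = proj₁ (joinExists p q p≢q)

    join-incident : {p q : Fin numPoints} → p ≢ q → T (inc p (join p q)) × T (inc q (join p q))
    join-incident {p} {q} p≢q with p ≟ q
    ... | yes p≡q = ⊥-elim (p≢q p≡q)
    ... | no  p≢q = proj₂ (joinExists p q p≢q)

    join-unique : {p q : Fin numPoints} {l : Fin numLines} → p ≢ q → T (inc p l) → T (inc q l) → join p q ≡ l
    join-unique p≢q p-on q-on = joinUnique _ _ p≢q _ _ (proj₁ (join-incident p≢q)) (proj₂ (join-incident p≢q)) p-on q-on

    count-incident : (l : Fin numLines) → count (λ x → inc x l) points ≡ suc n
    count-incident l = trans (sym (length-filterᵇ (λ x → inc x l) points)) (order l)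

    linesOf : List (Fin numPoints) → List (Fin numLines)
    linesOf ps = zipWith join ps (rotate ps)

    length-linesOf : (ps : List (Fin numPoints)) → length (linesOf ps) ≡ length ps
    length-linesOf ps = trans (length-zipWith join ps (rotate ps)) (trans (cong (length ps ⊓_) (length-rotate ps)) (⊓-idem _))

    linesOf-rotate^ : (r : ℕ) (ps : List (Fin numPoints)) → linesOf (rotate^ r ps) ≡ rotate^ r (linesOf ps)
    linesOf-rotate^ zero    ps = refl
    linesOf-rotate^ (suc r) ps = trans (linesOf-rotate^ r (rotate ps))
      (cong (rotate^ r) (zipWith-rotate join ps (rotate ps) (sym (length-rotate ps))))

    incident-joins : {xs ys : List (Fin numPoints)} → Pointwise _≢_ xs ys →
      T (and (zipWith inc xs (zipWith join xs ys))) × T (and (zipWith inc ys (zipWith join xs ys)))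
    incident-joins [] = tt , tt
    incident-joins (x≢y ∷ rest) with join-incident x≢y | incident-joins rest
    ... | x-on , y-on | xs-on , ys-on = from T-∧ (x-on , xs-on) , from T-∧ (y-on , ys-on)

    isCycleSeq-linesOf : (ps : List (Fin numPoints)) → 2 ≤ length ps →
      T (distinct ps) → T (distinct (linesOf ps)) → T (isCycleSeq Π ps (linesOf ps))
    isCycleSeq-linesOf ps 2≤ dist dist-lines with incident-joins (Unique⇒≢-rotate (distinct⇒Unique ps dist) 2≤)
    ... | on-left , on-right = from T-∧ (dist , from T-∧ (dist-lines , from T-∧ (on-left , on-right)))

    joins : List (Fin numPoints) → List (Fin numLines)
    joins (p ∷ q ∷ ps) = join p q ∷ joins (q ∷ ps)
    joins _            = []

    zipWith-join-∷ʳ : (p : Fin numPoints) (qs : List (Fin numPoints)) (r : Fin numPoints) →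
      ∃[ l ] zipWith join (p ∷ qs) (qs ∷ʳ r) ≡ joins (p ∷ qs) ∷ʳ l
    zipWith-join-∷ʳ p []       r = join p r , refl
    zipWith-join-∷ʳ p (q ∷ qs) r with zipWith-join-∷ʳ q qs r
    ... | l , eq = l , cong (join p q ∷_) eq

    ∈-joins⇒adjacentIn : {l : Fin numLines} (ps : List (Fin numPoints)) → Unique ps → l ∈ joins ps →
      T (adjacentIn (λ x → inc x l) ps)
    ∈-joins⇒adjacentIn (p ∷ q ∷ ps) ((p≢q ∷ _) ∷ _) (here refl) = from T-∨ (inj₁ (from T-∧ (join-incident p≢q)))
    ∈-joins⇒adjacentIn (p ∷ q ∷ ps) (_ ∷ uniq) (there l∈) = from T-∨ (inj₂ (∈-joins⇒adjacentIn (q ∷ ps) uniq l∈))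

    onJoin : Fin numPoints → Fin numPoints → Fin numPoints → Bool
    onJoin p q x = inc x (join p q)

    firstLineRecurs : List (Fin numPoints) → Bool
    firstLineRecurs (p₁ ∷ p₂ ∷ qs) = startsIn (onJoin p₁ p₂) qs ∨ adjacentIn (onJoin p₁ p₂) qs
    firstLineRecurs _              = false

    -- The last line of linesOf (p₁ ∷ p₂ ∷ qs) joins the last point back to p₁, so a repetition of
    -- the first line there would not be seen by firstLineRecurs.
    headRecursBeforeLast⇒firstLineRecurs : (ps : List (Fin numPoints)) → Unique ps →
      HeadRecursBeforeLast (linesOf ps) → T (firstLineRecurs ps)
    headRecursBeforeLast⇒firstLineRecurs (p ∷ []) _ (_ , []    , _ , () , _)
    headRecursBeforeLast⇒firstLineRecurs (p ∷ []) _ (_ , _ ∷ _ , _ , () , _)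
    headRecursBeforeLast⇒firstLineRecurs (p₁ ∷ p₂ ∷ qs) (_ ∷ uniq) (h , t , z , lines≡ , h∈t)
      with zipWith-join-∷ʳ p₂ qs p₁ | ∷-injective lines≡
    ... | l , rest≡ | refl , rest≡′ =
      adjacentIn-∷ (onJoin p₁ p₂) p₂ qs (∈-joins⇒adjacentIn (p₂ ∷ qs) uniq
        (subst (join p₁ p₂ ∈_) (sym (∷ʳ-injectiveˡ (joins (p₂ ∷ qs)) t (trans (sym rest≡) rest≡′))) h∈t))

    repeatedLines⇒firstLineRecurs : (ps : List (Fin numPoints)) → 3 ≤ length ps →
      T (distinct ps) → ¬ T (distinct (linesOf ps)) →
      ∃[ r ] r < length ps × T (firstLineRecurs (rotate^ r ps))
    repeatedLines⇒firstLineRecurs ps 3≤ dist nd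
      with nonDistinct⇒headRecursBeforeLast (linesOf ps) (subst (3 ≤_) (sym (length-linesOf ps)) 3≤) nd
    ... | r , r< , recurs = r , subst (r <_) (length-linesOf ps) r< ,
      headRecursBeforeLast⇒firstLineRecurs (rotate^ r ps) (Unique-rotate^ r (distinct⇒Unique ps dist))
        (subst HeadRecursBeforeLast (sym (linesOf-rotate^ r ps)) recurs)

    length-points : length points ≡ numPoints
    length-points = length-tabulate (λ i → i)

    count-firstLineRecurs : (t : ℕ) → count firstLineRecurs (tuples (4 + t) points) ≤ recurrenceBound n numPoints t
    count-firstLineRecurs t = begin
      count firstLineRecurs (tuples (4 + t) points)
        ≡⟨ count-tuples-suc firstLineRecurs (3 + t) points ⟩
      ∑[ p₁ ∈ points ] count (λ ps → firstLineRecurs (p₁ ∷ ps)) (tuples (3 + t) points)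
        ≡⟨ ∑-cong _ _ points (λ p₁ → count-tuples-suc _ (2 + t) points) ⟩
      ∑[ p₁ ∈ points ] ∑[ p₂ ∈ points ] count (λ qs → firstLineRecurs (p₁ ∷ p₂ ∷ qs)) (tuples (2 + t) points)
        ≤⟨ ∑-≤-const _ _ points (λ p₁ → ∑-≤-const _ _ points (λ p₂ → per-pair p₁ p₂)) ⟩
      length points * (length points * β)
        ≡⟨ cong (λ l → l * (l * β)) length-points ⟩
      numPoints * (numPoints * β)
        ∎
      where
      open ≤-Reasoning
      β = suc n * numPoints ^ suc t + suc t * (suc n * (suc n * numPoints ^ t))
      per-pair : ∀ p₁ p₂ → count (λ qs → firstLineRecurs (p₁ ∷ p₂ ∷ qs)) (tuples (2 + t) points) ≤ β
      per-pair p₁ p₂ = begin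
        count (λ qs → startsIn S qs ∨ adjacentIn S qs) (tuples (2 + t) points)
          ≤⟨ count-∨ (startsIn S) (adjacentIn S) (tuples (2 + t) points) ⟩
        count (startsIn S) (tuples (2 + t) points) + count (adjacentIn S) (tuples (2 + t) points)
          ≤⟨ +-mono-≤ (≤-reflexive (count-startsIn S (suc t) points)) (count-adjacentIn S t points) ⟩
        count S points * length points ^ suc t + suc t * (count S points * (count S points * length points ^ t))
          ≡⟨ cong₂ (λ c l → c * l ^ suc t + suc t * (c * (c * l ^ t))) (count-incident (join p₁ p₂)) length-points ⟩
        β
          ∎
        where S = onJoin p₁ p₂

    count-repeatedLines : (k : ℕ) → 3 ≤ k →
      count (λ ps → distinct ps ∧ not (distinct (linesOf ps))) (tuples k points) ≤ k * count firstLineRecurs (tuples k points)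
    count-repeatedLines k 3≤k = begin
      count (λ ps → distinct ps ∧ not (distinct (linesOf ps))) (tuples k points)
        ≤⟨ count-mono _ _ _ some-rotation ⟩
      count (λ ps → any (λ r → firstLineRecurs (rotate^ r ps)) (upTo k)) (tuples k points)
        ≤⟨ count-any (λ r ps → firstLineRecurs (rotate^ r ps)) (upTo k) (tuples k points) ⟩
      ∑[ r ∈ upTo k ] count (firstLineRecurs ∘ rotate^ r) (tuples k points)
        ≡⟨ ∑-cong _ _ (upTo k) (λ r → count-tuples-rotate^ firstLineRecurs r k points) ⟩
      ∑[ r ∈ upTo k ] count firstLineRecurs (tuples k points)
        ≡⟨ trans (∑-const _ (upTo k)) (cong (_* count firstLineRecurs (tuples k points)) (length-upTo k)) ⟩
      k * count firstLineRecurs (tuples k points)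
        ∎
      where
      open ≤-Reasoning
      some-rotation : ∀ ps → ps ∈ tuples k points → T (distinct ps ∧ not (distinct (linesOf ps))) →
                      T (any (λ r → firstLineRecurs (rotate^ r ps)) (upTo k))
      some-rotation ps ps∈ bad with to (T-∧ {distinct ps}) bad | ∈-tuples⁻ {m = k} ps∈
      ... | dist , lines-nd | refl with repeatedLines⇒firstLineRecurs ps 3≤k dist (subst T (to T-not-≡ lines-nd))
      ... | r , r< , recurs = any⁺ _ (lose (∈-upTo⁺ r<) recurs)

    count-distinctLines≤cycleSeqCount : (k : ℕ) → 2 ≤ k →
      count (λ ps → distinct ps ∧ distinct (linesOf ps)) (tuples k points) ≤ cycleSeqCount Π k
    count-distinctLines≤cycleSeqCount k 2≤k = begin
      count (λ ps → distinct ps ∧ distinct (linesOf ps)) (tuples k points)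
        ≤⟨ count-≤-∑ _ _ (tuples k points) cycle-for ⟩
      ∑[ ps ∈ tuples k points ] count (isCycleSeq Π ps) (tuples k lines)
        ≡⟨ count-concatMap isCycle _,_ (tuples k lines) (tuples k points) ⟨
      count isCycle pairs
        ≡⟨ length-filterᵇ isCycle pairs ⟨
      cycleSeqCount Π k
        ∎
      where
      open ≤-Reasoning
      isCycle : List (Fin numPoints) × List (Fin numLines) → Bool
      isCycle (ps , ls) = isCycleSeq Π ps ls
      pairs : List (List (Fin numPoints) × List (Fin numLines))
      pairs = concatMap (λ ps → map (ps ,_) (tuples k lines)) (tuples k points)
      cycle-for : ∀ ps → ps ∈ tuples k points → T (distinct ps ∧ distinct (linesOf ps)) →
                  1 ≤ count (isCycleSeq Π ps) (tuples k lines)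
      cycle-for ps ps∈ good with to (T-∧ {distinct ps}) good | ∈-tuples⁻ {m = k} ps∈
      ... | dist , dist-lines | refl = ∈⇒1≤count (isCycleSeq Π ps)
        (subst (λ m → linesOf ps ∈ tuples m lines) (length-linesOf ps) (∈-tuples⁺ (All.tabulate (λ {l} _ → ∈-allFin l))))
        (isCycleSeq-linesOf ps 2≤k dist dist-lines)

    -- Projecting from q onto l₀: every point x ≢ q lies on exactly one line q y with y on l₀,
    -- and each of these n + 1 lines carries n points besides q.
    module _ {l₀ : Fin numLines} {q : Fin numPoints} (q∉l₀ : ¬ T (inc q l₀)) where

      onL₀ : List (Fin numPoints)
      onL₀ = filterᵇ (λ y → inc y l₀) points

      ∈onL₀⁻ : {y : Fin numPoints} → y ∈ onL₀ → T (inc y l₀)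
      ∈onL₀⁻ y∈ = proj₂ (∈-filter⁻ (T? ∘ (λ y → inc y l₀)) {xs = points} y∈)

      projectsTo : Fin numPoints → Fin numPoints → Bool
      projectsTo y x = not ⌊ q ≟ x ⌋ ∧ onJoin q y x

      ≢q-on-l₀ : {y : Fin numPoints} → T (inc y l₀) → q ≢ y
      ≢q-on-l₀ y-on refl = q∉l₀ y-on

      projection-unique : (x : Fin numPoints) → q ≢ x → count (λ y → onJoin q y x) onL₀ ≡ 1
      projection-unique x q≢x with join-incident q≢x
      ... | q-on , x-on with meetExists (join q x) l₀ (λ { refl → q∉l₀ q-on })
      ... | y₀ , y₀-on , y₀-on-l₀ =
        count≡1 (λ y → onJoin q y x) (Unique.filter⁺ (T? ∘ (λ y → inc y l₀)) (Unique.allFin⁺ numPoints))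
          (∈-filter⁺ (T? ∘ (λ y → inc y l₀)) (∈-allFin y₀) y₀-on-l₀)
          (subst (λ l → T (inc x l)) (sym (join-unique (≢q-on-l₀ y₀-on-l₀) q-on y₀-on)) x-on)
          unique
        where
        unique : ∀ y y′ → y ∈ onL₀ → y′ ∈ onL₀ → T (onJoin q y x) → T (onJoin q y′ x) → y ≡ y′
        unique y y′ y∈ y′∈ x-on-qy x-on-qy′ =
          meetUnique (join q x) l₀ (λ { refl → q∉l₀ q-on }) y y′ (on-qx y∈ x-on-qy) (∈onL₀⁻ y∈)
                                                               (on-qx y′∈ x-on-qy′) (∈onL₀⁻ y′∈)
          where
          on-qx : ∀ {z} → z ∈ onL₀ → T (onJoin q z x) → T (inc z (join q x))
          on-qx {z} z∈ x-on-qz with ≢q-on-l₀ (∈onL₀⁻ z∈)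
          ... | q≢z = subst (λ l → T (inc z l)) (sym (join-unique q≢x (proj₁ (join-incident q≢z)) x-on-qz))
                            (proj₂ (join-incident q≢z))

      count-projectsTo : (y : Fin numPoints) → y ∈ onL₀ → count (projectsTo y) points ≡ n
      count-projectsTo y y∈ = suc-injective (begin
        suc (count (projectsTo y) points)
          ≡⟨ cong suc (count-cong _ _ points (λ x → ∧-comm (not ⌊ q ≟ x ⌋) (onJoin q y x))) ⟩
        suc (count (λ x → onJoin q y x ∧ not ⌊ q ≟ x ⌋) points)
          ≡⟨ cong (_+ count (λ x → onJoin q y x ∧ not ⌊ q ≟ x ⌋) points) only-q ⟨
        count (λ x → onJoin q y x ∧ ⌊ q ≟ x ⌋) points + count (λ x → onJoin q y x ∧ not ⌊ q ≟ x ⌋) points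
          ≡⟨ count-split (onJoin q y) (λ x → ⌊ q ≟ x ⌋) points ⟨
        count (onJoin q y) points
          ≡⟨ count-incident (join q y) ⟩
        suc n
          ∎)
        where
        open ≡-Reasoning
        q-on : T (inc q (join q y))
        q-on = proj₁ (join-incident (≢q-on-l₀ (∈onL₀⁻ y∈)))
        only-q : count (λ x → onJoin q y x ∧ ⌊ q ≟ x ⌋) points ≡ 1
        only-q = count≡1 _ (Unique.allFin⁺ numPoints) (∈-allFin q) (from T-∧ (q-on , fromWitness refl))
          (λ x x′ _ _ x-is-q x′-is-q → trans (sym (toWitness (proj₂ (to (T-∧ {onJoin q y x}) x-is-q))))
                                            (toWitness (proj₂ (to (T-∧ {onJoin q y x′}) x′-is-q))))

      point-partition : (x : Fin numPoints) →
        (if ⌊ q ≟ x ⌋ then 1 else 0) + (∑[ y ∈ onL₀ ] (if projectsTo y x then 1 else 0)) ≡ 1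
      point-partition x with q ≟ x
      ... | yes refl = cong suc (∑-zero onL₀)
      ... | no q≢x   = trans (sym (count-as-∑ _ onL₀)) (projection-unique x q≢x)

      numPoints≡ : numPoints ≡ Nn n
      numPoints≡ = begin
        numPoints
          ≡⟨ trans (sym length-points) (sym (trans (∑-const 1 points) (*-identityʳ _))) ⟩
        ∑[ x ∈ points ] 1
          ≡⟨ ∑-cong _ _ points (λ x → sym (point-partition x)) ⟩
        ∑[ x ∈ points ] ((if ⌊ q ≟ x ⌋ then 1 else 0) + (∑[ y ∈ onL₀ ] (if projectsTo y x then 1 else 0)))
          ≡⟨ ∑-+ _ _ points ⟩
        (∑[ x ∈ points ] (if ⌊ q ≟ x ⌋ then 1 else 0)) + (∑[ x ∈ points ] ∑[ y ∈ onL₀ ] (if projectsTo y x then 1 else 0))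
          ≡⟨ cong₂ _+_ (trans (sym (count-as-∑ _ points)) just-q) (∑-swap _ points onL₀) ⟩
        1 + (∑[ y ∈ onL₀ ] ∑[ x ∈ points ] (if projectsTo y x then 1 else 0))
          ≡⟨ cong (1 +_) (∑-cong-∈ _ _ onL₀ (λ y y∈ → trans (sym (count-as-∑ _ points)) (count-projectsTo y y∈))) ⟩
        1 + (∑[ _ ∈ onL₀ ] n)
          ≡⟨ cong (1 +_) (trans (∑-const n onL₀) (cong (_* n) (order l₀))) ⟩
        1 + suc n * n
          ≡⟨ arith n ⟩
        Nn n
          ∎
        where
        open ≡-Reasoning
        just-q : count (λ x → ⌊ q ≟ x ⌋) points ≡ 1
        just-q = count≡1 _ (Unique.allFin⁺ numPoints) (∈-allFin q) (fromWitness refl)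
                   (λ x x′ _ _ q≡x q≡x′ → trans (sym (toWitness q≡x)) (toWitness q≡x′))
        arith : ∀ n → 1 + suc n * n ≡ n * n + n + 1
        arith = solve-∀

    numPoints≡N : numPoints ≡ Nn n
    numPoints≡N = numPoints≡ (proj₂ (proj₂ lineWithPointOff))

    ff≤cycleSeqCount+ : (t : ℕ) → ff (Nn n) (4 + t) ≤ cycleSeqCount Π (4 + t) + (4 + t) * recurrenceBound n (Nn n) t
    ff≤cycleSeqCount+ t = subst (λ N → ff N k ≤ cycleSeqCount Π k + k * recurrenceBound n N t) numPoints≡N (begin
      ff numPoints k
        ≡⟨ trans (count-distinct-tuples k (Unique.allFin⁺ numPoints)) (cong (λ l → ff l k) length-points) ⟨
      count distinct (tuples k points)
        ≡⟨ count-split distinct (λ ps → distinct (linesOf ps)) (tuples k points) ⟩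
      count (λ ps → distinct ps ∧ distinct (linesOf ps)) (tuples k points)
        + count (λ ps → distinct ps ∧ not (distinct (linesOf ps))) (tuples k points)
        ≤⟨ +-mono-≤ (count-distinctLines≤cycleSeqCount k (s≤s (s≤s z≤n)))
                    (count-repeatedLines k (s≤s (s≤s (s≤s z≤n)))) ⟩
      cycleSeqCount Π k + k * count firstLineRecurs (tuples k points)
        ≤⟨ +-monoʳ-≤ (cycleSeqCount Π k) (*-monoʳ-≤ k (count-firstLineRecurs t)) ⟩
      cycleSeqCount Π k + k * recurrenceBound n numPoints t
        ∎)
      where
      open ≤-Reasoning
      k = 4 + t

  -- Estimates

  ff≤^ : ∀ x m → ff x m ≤ x ^ m
  ff≤^ x zero    = ≤-refl
  ff≤^ x (suc m) = ≤-trans (*-mono-≤ (ff≤^ x m) (m∸n≤m x m)) (≤-reflexive (*-comm (x ^ m) x))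

  x*ff≤ff+ : ∀ x j → x * ff x (suc j) ≤ ff x (suc (suc j)) + suc j * x ^ suc j
  x*ff≤ff+ x j = begin
    x * F                           ≤⟨ *-monoˡ-≤ F (m≤n+m∸n x (suc j)) ⟩
    (suc j + (x ∸ suc j)) * F       ≡⟨ trans (*-distribʳ-+ F (suc j) (x ∸ suc j)) (+-comm (suc j * F) _) ⟩
    (x ∸ suc j) * F + suc j * F     ≤⟨ +-mono-≤ (≤-reflexive (*-comm (x ∸ suc j) F)) (*-monoʳ-≤ (suc j) (ff≤^ x (suc j))) ⟩
    F * (x ∸ suc j) + suc j * x ^ suc j ∎
    where
    open ≤-Reasoning
    F = ff x (suc j)

  ^≤ff+ : ∀ x j → x ^ suc j ≤ ff x (suc j) + suc j * suc j * x ^ j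
  ^≤ff+ x zero = ≤-trans (≤-reflexive (arith x)) (m≤m+n (1 * x) 1)
    where
    arith : ∀ x → x * 1 ≡ 1 * x
    arith = solve-∀
  ^≤ff+ x (suc j) = begin
    x * x ^ suc j                                                    ≤⟨ *-monoʳ-≤ x (^≤ff+ x j) ⟩
    x * (ff x (suc j) + suc j * suc j * x ^ j)                       ≡⟨ *-distribˡ-+ x (ff x (suc j)) _ ⟩
    x * ff x (suc j) + x * (suc j * suc j * x ^ j)                   ≤⟨ +-monoˡ-≤ _ (x*ff≤ff+ x j) ⟩
    ff x (suc (suc j)) + suc j * x ^ suc j + x * (suc j * suc j * x ^ j)
      ≡⟨ arith (ff x (suc (suc j))) j x (x ^ j) ⟩
    ff x (suc (suc j)) + (suc j + suc j * suc j) * x ^ suc j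
      ≤⟨ +-monoʳ-≤ (ff x (suc (suc j))) (*-monoˡ-≤ (x ^ suc j) (m≤m+n (suc j + suc j * suc j) (suc (suc j)))) ⟩
    ff x (suc (suc j)) + (suc j + suc j * suc j + suc (suc j)) * x ^ suc j
      ≡⟨ cong (λ c → ff x (suc (suc j)) + c * x ^ suc j) (square j) ⟩
    ff x (suc (suc j)) + suc (suc j) * suc (suc j) * x ^ suc j       ∎
    where
    open ≤-Reasoning
    arith : ∀ F j x p → F + suc j * (x * p) + x * (suc j * suc j * p) ≡ F + (suc j + suc j * suc j) * (x * p)
    arith = solve-∀
    square : ∀ j → suc j + suc j * suc j + suc (suc j) ≡ suc (suc j) * suc (suc j)
    square = solve-∀

  ^-distribʳ-* : ∀ x y j → (x * y) ^ j ≡ x ^ j * y ^ j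
  ^-distribʳ-* x y zero    = refl
  ^-distribʳ-* x y (suc j) = trans (cong (x * y *_) (^-distribʳ-* x y j)) (arith x y (x ^ j) (y ^ j))
    where
    arith : ∀ x y p q → x * y * (p * q) ≡ x * p * (y * q)
    arith = solve-∀

  Nn≤3n² : ∀ a → Nn (suc a) ≤ 3 * (suc a * suc a)
  Nn≤3n² a = begin
    suc a * suc a + suc a + 1                  ≤⟨ +-mono-≤ (+-monoʳ-≤ (suc a * suc a) (m≤m*n (suc a) (suc a))) (s≤s z≤n) ⟩
    suc a * suc a + suc a * suc a + suc a * suc a ≡⟨ arith (suc a * suc a) ⟩
    3 * (suc a * suc a)                        ∎
    where
    open ≤-Reasoning
    arith : ∀ m → m + m + m ≡ 3 * m
    arith = solve-∀

  Nn^≤ : ∀ a j → Nn (suc a) ^ j ≤ 3 ^ j * (suc a ^ j * suc a ^ j)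
  Nn^≤ a j = ≤-trans (^-monoˡ-≤ j (Nn≤3n² a))
    (≤-reflexive (trans (^-distribʳ-* 3 _ j) (cong (3 ^ j *_) (^-distribʳ-* (suc a) (suc a) j))))

  -- With n = a + 1, the bounds a ≤ n², (a + 2)² ≤ 4n² and N ≤ 3n² turn each of the four error
  -- terms below into a multiple of n^(2t+6); errorConstant is the sum of the multipliers.
  errorConstant : ℕ → ℕ
  errorConstant t = 2 + (3 + t) * (3 + t) * 3 ^ (2 + t) + 2 * 3 ^ (3 + t) + 4 * (1 + t) * 3 ^ (2 + t)

  error-bound : ∀ t a → let n = suc a; N = Nn n in
    a * ((3 + t) * (3 + t)) * N ^ (2 + t) + (2 + 2 * N ^ (3 + t) + (1 + t) * ((a + 2) * (a + 2)) * N ^ (2 + t))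
      ≤ errorConstant t * (n ^ (3 + t) * n ^ (3 + t))
  error-bound t a = begin
    a * s * N ^ (2 + t) + (2 + 2 * N ^ (3 + t) + (1 + t) * ((a + 2) * (a + 2)) * N ^ (2 + t))
      ≤⟨ +-mono-≤ (*-mono-≤ (*-monoˡ-≤ s a≤n²) (Nn^≤ a (2 + t)))
                  (+-mono-≤ (+-mono-≤ two (*-monoʳ-≤ 2 (Nn^≤ a (3 + t))))
                            (*-mono-≤ (*-monoʳ-≤ (1 + t) square) (Nn^≤ a (2 + t)))) ⟩
    n * n * s * (V * (R * R)) + (2 * (n * n * (R * R)) + 2 * (3 * V * (n * R * (n * R))) + (1 + t) * (4 * (n * n)) * (V * (R * R)))
      ≡⟨ arith t V n R ⟩
    errorConstant t * (n ^ (3 + t) * n ^ (3 + t))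
      ∎
    where
    open ≤-Reasoning
    n = suc a
    N = Nn n
    s = (3 + t) * (3 + t)
    V = 3 ^ (2 + t)
    R = n ^ (2 + t)
    two : 2 ≤ 2 * (n * n * (R * R))
    two = *-monoʳ-≤ 2 (*-mono-≤ (*-mono-≤ 1≤n 1≤n) (*-mono-≤ (m^n>0 n (2 + t)) (m^n>0 n (2 + t))))
      where
      1≤n : 1 ≤ n
      1≤n = s≤s z≤n
    a≤n² : a ≤ n * n
    a≤n² = ≤-trans (n≤1+n a) (m≤m*n n n)
    square : (a + 2) * (a + 2) ≤ 4 * (n * n)
    square = ≤-trans (*-mono-≤ a+2≤2n a+2≤2n) (≤-reflexive (arith′ a))
      where
      a+2≤2n : a + 2 ≤ n + n
      a+2≤2n = ≤-trans (≤-reflexive (+-comm a 2)) (s≤s (m≤n+m (suc a) a))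
      arith′ : ∀ a → (suc a + suc a) * (suc a + suc a) ≡ 4 * (suc a * suc a)
      arith′ = solve-∀
    arith : ∀ t V n R →
      n * n * ((3 + t) * (3 + t)) * (V * (R * R))
        + (2 * (n * n * (R * R)) + 2 * (3 * V * (n * R * (n * R))) + (1 + t) * (4 * (n * n)) * (V * (R * R)))
      ≡ (2 + (3 + t) * (3 + t) * V + 2 * (3 * V) + 4 * (1 + t) * V) * (n * R * (n * R))
    arith = solve-∀

  exponent-split : ∀ t → 2 * (4 + t) ∸ 2 ≡ (3 + t) + (3 + t)
  exponent-split t = cong (_∸ 2) (arith t)
    where
    arith : ∀ t → 2 * (4 + t) ≡ 2 + ((3 + t) + (3 + t))
    arith = solve-∀

  excess-bound : ∀ t a → let n = suc a; N = Nn n in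
    2 + recurrenceBound n N t ≤ a * ff N (3 + t) + errorConstant t * n ^ (2 * (4 + t) ∸ 2)
  excess-bound t a = begin
    2 + recurrenceBound n N t
      ≡⟨ arith₁ a t N (N ^ t) ⟩
    a * N ^ (3 + t) + rest
      ≤⟨ +-monoˡ-≤ rest (*-monoʳ-≤ a (^≤ff+ N (2 + t))) ⟩
    a * (ff N (3 + t) + (3 + t) * (3 + t) * N ^ (2 + t)) + rest
      ≡⟨ arith₂ a (ff N (3 + t)) ((3 + t) * (3 + t)) (N ^ (2 + t)) rest ⟩
    a * ff N (3 + t) + (a * ((3 + t) * (3 + t)) * N ^ (2 + t) + rest)
      ≤⟨ +-monoʳ-≤ (a * ff N (3 + t)) (error-bound t a) ⟩
    a * ff N (3 + t) + errorConstant t * (n ^ (3 + t) * n ^ (3 + t))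
      ≡⟨ cong (λ e → a * ff N (3 + t) + errorConstant t * e)
              (trans (sym (^-distribˡ-+-* n (3 + t) (3 + t))) (cong (n ^_) (sym (exponent-split t)))) ⟩
    a * ff N (3 + t) + errorConstant t * n ^ (2 * (4 + t) ∸ 2)
      ∎
    where
    open ≤-Reasoning
    n = suc a
    N = Nn n
    rest = 2 + 2 * N ^ (3 + t) + (1 + t) * ((a + 2) * (a + 2)) * N ^ (2 + t)
    arith₁ : ∀ a t N P →
      2 + N * (N * (suc (suc a) * (N * P) + suc t * (suc (suc a) * (suc (suc a) * P))))
        ≡ a * (N * (N * (N * P))) + (2 + 2 * (N * (N * (N * P))) + (1 + t) * ((a + 2) * (a + 2)) * (N * (N * P)))
    arith₁ = solve-∀
    arith₂ : ∀ a Y s M r → a * (Y + s * M) + r ≡ a * Y + (a * s * M + r)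
    arith₂ = solve-∀

  m<n+[m/n]*n : ∀ m n .{{_ : NonZero n}} → m < n + m / n * n
  m<n+[m/n]*n m n = subst (_< n + m / n * n) (sym (m≡m%n+[m/n]*n m n)) (+-monoˡ-< (m / n * n) (m%n<n m n))

  levi-c-bound : ∀ t a (Π : ProjectivePlane (suc a)) → let k = 4 + t; N = Nn (suc a) in
    ff N k < 2 * k * levi-c Π k + k * a * ff N (3 + t) + k * (errorConstant t * suc a ^ (2 * k ∸ 2))
  levi-c-bound t a Π = begin-strict
    ff N k                           ≤⟨ ff≤cycleSeqCount+ Π t ⟩
    seqs + k * D                     <⟨ +-monoˡ-< (k * D) (m<n+[m/n]*n seqs (2 * k)) ⟩
    2 * k + levi-c Π k * (2 * k) + k * D
      ≡⟨ arith₁ k (levi-c Π k) D ⟩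
    2 * k * levi-c Π k + k * (2 + D)
      ≤⟨ +-monoʳ-≤ (2 * k * levi-c Π k) (*-monoʳ-≤ k (excess-bound t a)) ⟩
    2 * k * levi-c Π k + k * (a * ff N (3 + t) + errorConstant t * suc a ^ (2 * k ∸ 2))
      ≡⟨ arith₂ k (levi-c Π k) a (ff N (3 + t)) (errorConstant t * suc a ^ (2 * k ∸ 2)) ⟩
    2 * k * levi-c Π k + k * a * ff N (3 + t) + k * (errorConstant t * suc a ^ (2 * k ∸ 2))
      ∎
    where
    open ≤-Reasoning
    k = 4 + t
    n = suc a
    N = Nn n
    seqs = cycleSeqCount Π k
    D = recurrenceBound n N t
    arith₁ : ∀ k L D → 2 * k + L * (2 * k) + k * D ≡ 2 * k * L + k * (2 + D)
    arith₁ = solve-∀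
    arith₂ : ∀ k L a Y E → 2 * k * L + k * (a * Y + E) ≡ 2 * k * L + k * a * Y + k * E
    arith₂ = solve-∀

open Combinatorics using (errorConstant; levi-c-bound)

-- Passing to rationals

open import Data.Nat using (ℕ; zero; suc; NonZero; _≤_; _^_; _∸_; s≤s)
  renaming (_+_ to _+ℕ_; _*_ to _*ℕ_; _<_ to _<ℕ_)
import Data.Nat.Properties as ℕₚ
open import Data.Nat.Tactic.RingSolver using (solve-∀)
open import Data.Integer using (+_; +<+) renaming (_*_ to _*ℤ_; _+_ to _+ℤ_)
import Data.Integer as ℤ
import Data.Integer.Properties as ℤ
open import Data.Product using (∃; _,_)
open import Data.Rational using (ℚ; _<_; _-_; _*_; _+_; -_; 0ℚ; toℚᵘ; NonNegative) renaming (_≤_ to _≤ℚ_)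
open import Data.Rational.Properties
import Data.Rational.Unnormalised as ℚᵘ
import Data.Rational.Unnormalised.Properties as ℚᵘ
open import Data.Rational.Solver using (module +-*-Solver)
open import Relation.Binary.PropositionalEquality

toℚᵘ-frac : ∀ m d → toℚᵘ (frac m (suc d)) ℚᵘ.≃ ℚᵘ.mkℚᵘ (+ m) d
toℚᵘ-frac m d = toℚᵘ-fromℚᵘ (ℚᵘ.mkℚᵘ (+ m) d)

ℕ→ℚ-+ : ∀ a b → ℕ→ℚ (a +ℕ b) ≡ ℕ→ℚ a + ℕ→ℚ b
ℕ→ℚ-+ a b = toℚᵘ-injective (ℚᵘ.≃-trans (toℚᵘ-frac (a +ℕ b) 0) (ℚᵘ.≃-sym
  (ℚᵘ.≃-trans (toℚᵘ-homo-+ (ℕ→ℚ a) (ℕ→ℚ b)) (ℚᵘ.≃-trans (ℚᵘ.+-cong (toℚᵘ-frac a 0) (toℚᵘ-frac b 0))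
    (ℚᵘ.*≡* (cong (_*ℤ + 1) (trans (cong₂ _+ℤ_ (ℤ.*-identityʳ (+ a)) (ℤ.*-identityʳ (+ b)))
                                  (sym (ℤ.pos-+ a b)))))))))

ℕ→ℚ-* : ∀ a b → ℕ→ℚ (a *ℕ b) ≡ ℕ→ℚ a * ℕ→ℚ b
ℕ→ℚ-* a b = toℚᵘ-injective (ℚᵘ.≃-trans (toℚᵘ-frac (a *ℕ b) 0) (ℚᵘ.≃-sym
  (ℚᵘ.≃-trans (toℚᵘ-homo-* (ℕ→ℚ a) (ℕ→ℚ b)) (ℚᵘ.≃-trans (ℚᵘ.*-cong (toℚᵘ-frac a 0) (toℚᵘ-frac b 0))
    (ℚᵘ.*≡* (cong (_*ℤ + 1) (sym (ℤ.pos-* a b))))))))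

ℕ→ℚ-mono-< : ∀ {a b} → a <ℕ b → ℕ→ℚ a < ℕ→ℚ b
ℕ→ℚ-mono-< {a} {b} a<b = toℚᵘ-cancel-<
  (ℚᵘ.<-respˡ-≃ (ℚᵘ.≃-sym (toℚᵘ-frac a 0)) (ℚᵘ.<-respʳ-≃ (ℚᵘ.≃-sym (toℚᵘ-frac b 0))
    (ℚᵘ.*<* (subst₂ ℤ._<_ (sym (ℤ.*-identityʳ (+ a))) (sym (ℤ.*-identityʳ (+ b))) (+<+ a<b)))))

*-frac : ∀ m d .{{_ : NonZero d}} → ℕ→ℚ d * frac m d ≡ ℕ→ℚ m
*-frac m (suc d) = toℚᵘ-injective (ℚᵘ.≃-trans (toℚᵘ-homo-* (ℕ→ℚ (suc d)) (frac m (suc d)))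
  (ℚᵘ.≃-trans (ℚᵘ.*-cong (toℚᵘ-frac (suc d) 0) (toℚᵘ-frac m d))
    (ℚᵘ.≃-trans cancel (ℚᵘ.≃-sym (toℚᵘ-frac m 0)))))
  where
  arith : ∀ d m → suc d *ℕ m ≡ m *ℕ suc (d +ℕ 0)
  arith = solve-∀
  cancel : ℚᵘ.mkℚᵘ (+ suc d) 0 ℚᵘ.* ℚᵘ.mkℚᵘ (+ m) d ℚᵘ.≃ ℚᵘ.mkℚᵘ (+ m) 0
  cancel = ℚᵘ.*≡* (trans (ℤ.*-identityʳ _)
    (trans (sym (ℤ.pos-* (suc d) m)) (trans (cong +_ (arith d m)) (ℤ.pos-* m (suc (d +ℕ 0))))))

-- The c-term is nonnegative and is simply dropped.
ℕ-bound⇒ℚ-bound : ∀ (k X L a c Y A Z : ℕ) → X <ℕ 2 *ℕ suc k *ℕ L +ℕ suc k *ℕ a *ℕ Y +ℕ suc k *ℕ (A *ℕ Z) →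
  frac X (2 *ℕ suc k) - frac a 2 * ℕ→ℚ Y - frac c (2 *ℕ suc k) * ℕ→ℚ Y - frac A 2 * ℕ→ℚ Z < ℕ→ℚ L
ℕ-bound⇒ℚ-bound k X L a c Y A Z X< = ≤-<-trans drop-c-term (*-cancelˡ-<-nonNeg K K*R<K*L)
  where
  open +-*-Solver
  K  = ℕ→ℚ (2 *ℕ suc k)
  k′ = ℕ→ℚ (suc k)
  y  = ℕ→ℚ Y
  z  = ℕ→ℚ Z
  R  = frac X (2 *ℕ suc k) - frac a 2 * y - frac A 2 * z
  S  = k′ * ℕ→ℚ a * y + k′ * ℕ→ℚ A * z
  instance
    K-nonNeg : NonNegative K
    K-nonNeg = normalize-nonNeg (2 *ℕ suc k) 1
  drop-c-term : frac X (2 *ℕ suc k) - frac a 2 * y - frac c (2 *ℕ suc k) * y - frac A 2 * z ≤ℚ R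
  drop-c-term = begin
    frac X (2 *ℕ suc k) - frac a 2 * y - v * y - frac A 2 * z
      ≡⟨ solve 4 (λ p q r s → p :- q :- r :- s := (p :- q :- s) :+ (:- r)) refl
                 (frac X (2 *ℕ suc k)) (frac a 2 * y) (v * y) (frac A 2 * z) ⟩
    R + - (v * y)
      ≤⟨ +-monoʳ-≤ R (neg-antimono-≤ (nonNegative⁻¹ (v * y) {{v*y-nonNeg}})) ⟩
    R + 0ℚ
      ≡⟨ +-identityʳ R ⟩
    R ∎
    where
    open ≤-Reasoning
    v = frac c (2 *ℕ suc k)
    v*y-nonNeg : NonNegative (v * y)
    v*y-nonNeg = nonNeg*nonNeg⇒nonNeg v {{normalize-nonNeg c _}} y {{normalize-nonNeg Y 1}}
  K*half : ∀ m → K * frac m 2 ≡ k′ * ℕ→ℚ m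
  K*half m = begin
    K * frac m 2                     ≡⟨ cong (_* frac m 2) (trans (cong ℕ→ℚ (ℕₚ.*-comm 2 (suc k))) (ℕ→ℚ-* (suc k) 2)) ⟩
    k′ * ℕ→ℚ 2 * frac m 2            ≡⟨ *-assoc k′ (ℕ→ℚ 2) (frac m 2) ⟩
    k′ * (ℕ→ℚ 2 * frac m 2)          ≡⟨ cong (k′ *_) (*-frac m 2) ⟩
    k′ * ℕ→ℚ m                       ∎
    where open ≡-Reasoning
  K*R : K * R ≡ ℕ→ℚ X - S
  K*R = begin
    K * R
      ≡⟨ solve 6 (λ K x u y w z → K :* (x :- u :* y :- w :* z) := K :* x :- (K :* u) :* y :- (K :* w) :* z) refl
                 K (frac X (2 *ℕ suc k)) (frac a 2) y (frac A 2) z ⟩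
    K * frac X (2 *ℕ suc k) - (K * frac a 2) * y - (K * frac A 2) * z
      ≡⟨ cong₂ (λ p q → p - q * y - K * frac A 2 * z) (*-frac X (2 *ℕ suc k)) (K*half a) ⟩
    ℕ→ℚ X - (k′ * ℕ→ℚ a) * y - (K * frac A 2) * z
      ≡⟨ cong (λ q → ℕ→ℚ X - k′ * ℕ→ℚ a * y - q * z) (K*half A) ⟩
    ℕ→ℚ X - k′ * ℕ→ℚ a * y - k′ * ℕ→ℚ A * z
      ≡⟨ solve 3 (λ x p q → x :- p :- q := x :- (p :+ q)) refl (ℕ→ℚ X) (k′ * ℕ→ℚ a * y) (k′ * ℕ→ℚ A * z) ⟩
    ℕ→ℚ X - S
      ∎
    where open ≡-Reasoning
  K*R<K*L : K * R < K * ℕ→ℚ L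
  K*R<K*L = begin-strict
    K * R                          ≡⟨ K*R ⟩
    ℕ→ℚ X - S                      <⟨ +-monoˡ-< (- S) (subst (ℕ→ℚ X <_) cast (ℕ→ℚ-mono-< X<)) ⟩
    K * ℕ→ℚ L + S - S              ≡⟨ solve 2 (λ p s → p :+ s :- s := p) refl (K * ℕ→ℚ L) S ⟩
    K * ℕ→ℚ L                      ∎
    where
    open ≤-Reasoning
    cast : ℕ→ℚ (2 *ℕ suc k *ℕ L +ℕ suc k *ℕ a *ℕ Y +ℕ suc k *ℕ (A *ℕ Z)) ≡ K * ℕ→ℚ L + S
    cast = trans (ℕ→ℚ-+ (2 *ℕ suc k *ℕ L +ℕ suc k *ℕ a *ℕ Y) (suc k *ℕ (A *ℕ Z)))
      (trans (cong₂ _+_ (trans (ℕ→ℚ-+ (2 *ℕ suc k *ℕ L) (suc k *ℕ a *ℕ Y))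
                               (cong₂ _+_ (ℕ→ℚ-* (2 *ℕ suc k) L)
                                          (trans (ℕ→ℚ-* (suc k *ℕ a) Y) (cong (_* y) (ℕ→ℚ-* (suc k) a)))))
                        (trans (ℕ→ℚ-* (suc k) (A *ℕ Z)) (cong (k′ *_) (ℕ→ℚ-* A Z))))
             (solve 6 (λ p q y r A z → p :+ q :* y :+ r :* (A :* z) := p :+ (q :* y :+ r :* A :* z)) refl
                      (K * ℕ→ℚ L) (k′ * ℕ→ℚ a) y k′ (ℕ→ℚ A) z))

theorem3 : ∀ (k : ℕ) → 4 ≤ k →
    ∃ λ (a : ℚ) → ∀ (n : ℕ) → k ≤ n → (Π : ProjectivePlane n) →
    frac (ff (Nn n) k) (2 *ℕ k)
    - frac (n ∸ 1) 2 * ℕ→ℚ (ff (Nn n) (k ∸ 1))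
    - frac ((k ∸ 1) *ℕ (k ∸ 2)) (2 *ℕ k) * ℕ→ℚ (ff (Nn n) (k ∸ 1))
    - a * ℕ→ℚ (n ^ (2 *ℕ k ∸ 2))
    < ℕ→ℚ (levi-c Π k)
-- The hypothesis k ≤ n only serves to exclude n = 0.
theorem3 (suc (suc (suc (suc t)))) (s≤s (s≤s (s≤s (s≤s _)))) = frac (errorConstant t) 2 , λ
  { zero () _
  ; (suc a) _ Π → ℕ-bound⇒ℚ-bound (3 +ℕ t) (ff (Nn (suc a)) (4 +ℕ t)) (levi-c Π (4 +ℕ t)) a ((3 +ℕ t) *ℕ (2 +ℕ t))
                    (ff (Nn (suc a)) (3 +ℕ t)) (errorConstant t) (suc a ^ (2 *ℕ (4 +ℕ t) ∸ 2)) (levi-c-bound t a Π)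
  }
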